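{- Let $D$ be a loose multipartite tournament. Then: (1) each connected component of $C_{1,2}(D)$ has diameter at most two; (2) $D$ has no sinks if and only if $C_{1,2}(D)$ is connected; (3) every stable set of $C_{1,2}(D)$ intersects at most two partite sets of $D$; (4) $D$ has at most two partite sets that are not $\{1,2\}$-competing; (5) if $D$ has exactly $m$ sinks and $C_{1,2}(D)$ has at least one edge, then the domination number $\gamma(C_{1,2}(D))$ belongs to $\{m+1,m+2\}$.
   Context: All graphs and digraphs are finite and simple. For a digraph $D$, a sink is a vertex of outdegree $0$; $d_D(x,y)$ is the length of a shortest directed path from $x$ to $y$. The $(1,2)$-step competition graph $C_{1,2}(D)$ is the graph on $V(D)$ in which distinct $u,v$ are adjacent iff there is a vertex $w\notin\{u,v\}$ with either $d_{D-v}(u,w)\le 1$ and $d_{D-u}(v,w)\le 2$, or $d_{D-u}(v,w)\le 1$ and $d_{D-v}(u,w)\le 2$. A multipartite tournament is an orientation of a complete $k$-partite graph for some $k\ge3$ (with nonempty partite sets). A set of vertices is $\{1,2\}$-competing if it is a clique in $C_{1,2}(D)$. A multipartite tournament is loose if some partite set is not $\{1,2\}$-competing. The domination number $\gamma(G)$ of a graph $G$ is the minimum size of a set $S$ such that every vertex is in $S$ or adjacent to a vertex of $S$. -}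

module Defs where

open import Data.Nat using (ℕ; zero; suc; _≤_)
open import Data.Bool using (Bool; true; false)
open import Data.Fin using (Fin)
open import Data.Fin.Subset using (Subset; _∈_; ∣_∣)
open import Data.Fin.Properties using (all?)
open import Data.Bool.Properties using () renaming (_≟_ to _≟ᵇ_)
open import Data.List using (length; filter)
open import Data.List.Base using ()
open import Data.Fin.Base using ()
open import Data.List using (List)
open import Data.Product using (Σ; ∃; _×_; _,_)
open import Data.Sum using (_⊎_)
open import Relation.Nullary using (¬_)
open import Relation.Binary.PropositionalEquality using (_≡_; _≢_)
import Data.Vec.Functional as VF
open import Data.List using () renaming (tabulate to ltabulate)

Digraph : ℕ → Set
Digraph n = Fin n → Fin n → Bool

Arc : ∀ {n} → Digraph n → Fin n → Fin n → Set
Arc D u v = D u v ≡ true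

-- D with partite map p : Fin n → Fin k (partite sets = fibres of p)
-- is a multipartite tournament: an orientation of the complete k-partite
-- graph with k ≥ 3 nonempty partite sets.
record IsMultipartiteTournament {n : ℕ} (k : ℕ) (p : Fin n → Fin k) (D : Digraph n) : Set where
  field
    atLeast3Parts : 3 ≤ k
    partsNonempty : ∀ (i : Fin k) → ∃ λ v → p v ≡ i
    noArcInPart   : ∀ u v → p u ≡ p v → D u v ≡ false
    orientation   : ∀ u v → p u ≢ p v →
                      (D u v ≡ true × D v u ≡ false) ⊎ (D u v ≡ false × D v u ≡ true)

Sink : ∀ {n} → Digraph n → Fin n → Set
Sink D x = ∀ y → D x y ≡ false

numSinks : ∀ {n} → Digraph n → ℕ
numSinks {n} D = length (filter (λ x → all? (λ y → D x y ≟ᵇ false)) (ltabulate {n = n} (λ i → i)))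

-- WalkAvoiding D a k x y : there is a directed walk of length ≤ k from x to y
-- in D - a (all its vertices differ from a).  Hence d_{D-a}(x,y) ≤ k
-- iff WalkAvoiding D a k x y (for x ≠ a).
data WalkAvoiding {n} (D : Digraph n) (a : Fin n) : ℕ → Fin n → Fin n → Set where
  here  : ∀ {k x} → x ≢ a → WalkAvoiding D a k x x
  step  : ∀ {k x y z} → x ≢ a → Arc D x y → WalkAvoiding D a k y z →
          WalkAvoiding D a (suc k) x z

C12 : ∀ {n} → Digraph n → Fin n → Fin n → Set
C12 D u v = u ≢ v × ∃ λ w → w ≢ u × w ≢ v ×
  ((WalkAvoiding D v 1 u w × WalkAvoiding D u 2 v w) ⊎
   (WalkAvoiding D u 1 v w × WalkAvoiding D v 2 u w))

Graph : ℕ → Set₁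
Graph n = Fin n → Fin n → Set

data Connected {n} (G : Graph n) : Fin n → Fin n → Set where
  refl′ : ∀ {x} → Connected G x x
  edge  : ∀ {x y z} → G x y → Connected G y z → Connected G x z

Dist≤2 : ∀ {n} → Graph n → Fin n → Fin n → Set
Dist≤2 G u v = u ≡ v ⊎ G u v ⊎ ∃ λ x → G u x × G x v

ComponentsDiam≤2 : ∀ {n} → Graph n → Set
ComponentsDiam≤2 G = ∀ u v → Connected G u v → Dist≤2 G u v

IsConnectedGraph : ∀ {n} → Graph n → Set
IsConnectedGraph G = ∀ u v → Connected G u v

Stable : ∀ {n} → Graph n → Subset n → Set
Stable G S = ∀ u v → u ∈ S → v ∈ S → ¬ G u v

Clique : ∀ {n} → Graph n → (Fin n → Set) → Set
Clique G P = ∀ u v → P u → P v → u ≢ v → G u v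

Competing : ∀ {n k} → (Fin n → Fin k) → Digraph n → Fin k → Set
Competing p D i = Clique (C12 D) (λ v → p v ≡ i)

Loose : ∀ {n k} → (Fin n → Fin k) → Digraph n → Set
Loose {k = k} p D = ∃ λ (i : Fin k) → ¬ Competing p D i

HasEdge : ∀ {n} → Graph n → Set
HasEdge G = ∃ λ u → ∃ λ v → G u v

Dominating : ∀ {n} → Graph n → Subset n → Set
Dominating G S = ∀ v → v ∈ S ⊎ ∃ λ u → u ∈ S × G u v

IsDominationNumber : ∀ {n} → Graph n → ℕ → Set
IsDominationNumber {n} G g =
  (∃ λ (S : Subset n) → Dominating G S × ∣ S ∣ ≡ g) ×
  (∀ (S : Subset n) → Dominating G S → g ≤ ∣ S ∣)

{-# OPTIONS --safe #-}
-- Sinks are isolated in C₁,₂(D), so everything happens among the non-sinks.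
-- A loose part contains vertices x, y that are non-adjacent in C₁,₂(D).  If y
-- is a sink, every vertex outside its part points to y.  Otherwise
-- non-adjacency forces all out-neighbours of x and y into one part (side),
-- every vertex outside the part of x (core) to point to x or y, and every
-- vertex outside core ∪ side to point to both.  Either way each vertex outside
-- core has an out-neighbour h receiving arcs from all vertices outside
-- core ∪ side.  So two vertices outside core, one of them also outside side,
-- have a common out-neighbour and are adjacent: this gives (3) and (4).
-- Pick c₁ outside core ∪ side and c₂ in a third part.  Every non-sink is c₁,
-- adjacent to c₁, or a vertex of core with an arc to c₁, and the latter is
-- adjacent to c₂ and within distance two of every non-sink.  Hence the
-- non-sinks form a single component of diameter at most two dominated by
-- {c₁, c₂}, which gives (1), (2) and (5).
module Submission where

open import Defs
open import Data.Nat using (ℕ; _+_)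
open import Data.Fin using (Fin)
open import Data.Fin.Subset using (Subset; _∈_)
open import Data.Product using (_×_; ∃)
open import Data.Sum using (_⊎_)
open import Relation.Nullary using (¬_)
open import Relation.Binary.PropositionalEquality using (_≡_)
open import Function.Bundles using (_⇔_)

open import Data.Bool using (true; false)
open import Data.Bool.Properties using (¬-not) renaming (_≟_ to _≟ᵇ_)
open import Data.Empty using (⊥-elim)
open import Data.Fin using (zero; suc; _≟_)
open import Data.Fin.Properties using (any?; all?; ¬∀⟶∃¬)
open import Data.Fin.Subset using (outside; inside; _∪_; ⁅_⁆; ∣_∣; _⊂_)
open import Data.Fin.Subset.Properties using (_∈?_; x∈p∪q⁺; x∈⁅x⁆; ∣⁅x⁆∣≡1; p⊂q⇒∣p∣<∣q∣)
import Data.List as List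
open import Data.Nat using (zero; suc; _≤_; _<_; s≤s; z≤n)
open import Data.Nat.Properties
  using (≤-trans; ≤-reflexive; ≤-antisym; +-suc; +-comm; +-monoʳ-≤; n≤1+n; m≤n⇒m<n∨m≡n)
open import Data.Product using (∃₂; _,_; proj₁; proj₂)
open import Data.Sum using (inj₁; inj₂)
open import Data.Vec using ([]; _∷_; tabulate)
open import Data.Vec.Properties using (lookup⇒[]=; []=⇒lookup; lookup∘tabulate)
open import Function using (_∘_)
open import Function.Bundles using (mk⇔)
open import Relation.Nullary using (Dec; yes; no; does)
open import Relation.Nullary.Decidable using (_×-dec_; _⊎-dec_; ¬?; map′; decidable-stable)
open import Relation.Unary using (Decidable)
open import Relation.Binary.PropositionalEquality
  using (_≢_; refl; sym; trans; cong; cong₂; subst; ≢-sym)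

fresh : ∀ {k} → 3 ≤ k → (i j : Fin k) → ∃ λ l → l ≢ i × l ≢ j
fresh (s≤s (s≤s (s≤s _))) zero    zero          = suc zero , (λ ()) , (λ ())
fresh (s≤s (s≤s (s≤s _))) zero    (suc zero)    = suc (suc zero) , (λ ()) , (λ ())
fresh (s≤s (s≤s (s≤s _))) zero    (suc (suc _)) = suc zero , (λ ()) , (λ ())
fresh (s≤s (s≤s (s≤s _))) (suc zero) zero       = suc (suc zero) , (λ ()) , (λ ())
fresh (s≤s (s≤s (s≤s _))) (suc zero) (suc _)    = zero , (λ ()) , (λ ())
fresh (s≤s (s≤s (s≤s _))) (suc (suc _)) zero    = suc zero , (λ ()) , (λ ())
fresh (s≤s (s≤s (s≤s _))) (suc (suc _)) (suc _) = zero , (λ ()) , (λ ())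

m<g≤m+2⇒g≡m+1⊎g≡m+2 : ∀ m g → m < g → g ≤ m + 2 → g ≡ m + 1 ⊎ g ≡ m + 2
m<g≤m+2⇒g≡m+1⊎g≡m+2 m g m<g g≤m+2 rewrite +-comm m 1 | +-comm m 2 with m≤n⇒m<n∨m≡n m<g
... | inj₁ 1+m<g = inj₂ (≤-antisym g≤m+2 1+m<g)
... | inj₂ 1+m≡g = inj₁ (sym 1+m≡g)

∣p∪q∣≤∣p∣+∣q∣ : ∀ {n} (p q : Subset n) → ∣ p ∪ q ∣ ≤ ∣ p ∣ + ∣ q ∣
∣p∪q∣≤∣p∣+∣q∣ []            []            = z≤n
∣p∪q∣≤∣p∣+∣q∣ (outside ∷ p) (outside ∷ q) = ∣p∪q∣≤∣p∣+∣q∣ p q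
∣p∪q∣≤∣p∣+∣q∣ (outside ∷ p) (inside ∷ q)  =
  ≤-trans (s≤s (∣p∪q∣≤∣p∣+∣q∣ p q)) (≤-reflexive (sym (+-suc ∣ p ∣ ∣ q ∣)))
∣p∪q∣≤∣p∣+∣q∣ (inside ∷ p)  (outside ∷ q) = s≤s (∣p∪q∣≤∣p∣+∣q∣ p q)
∣p∪q∣≤∣p∣+∣q∣ (inside ∷ p)  (inside ∷ q)  =
  s≤s (≤-trans (∣p∪q∣≤∣p∣+∣q∣ p q) (+-monoʳ-≤ ∣ p ∣ (n≤1+n ∣ q ∣)))

length-filter-tabulate : ∀ {n m} {P : Fin m → Set} (P? : Decidable P) (f : Fin n → Fin m) →
  List.length (List.filter P? (List.tabulate f)) ≡ ∣ tabulate (does ∘ P? ∘ f) ∣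
length-filter-tabulate {zero}  P? f = refl
length-filter-tabulate {suc n} P? f with P? (f zero)
... | yes _ = cong suc (length-filter-tabulate P? (f ∘ suc))
... | no  _ = length-filter-tabulate P? (f ∘ suc)

module TwoCentres {n} (G : Graph n) (G-sym : ∀ {u v} → G u v → G v u)
  {I : Fin n → Set} (I? : Decidable I) (isolated : ∀ {u v} → G u v → ¬ I u)
  (c₁ c₂ : Fin n) (c₁-active : ¬ I c₁)
  (classify : ∀ v → ¬ I v →
     (v ≡ c₁ ⊎ G c₁ v) ⊎ (G c₂ v × ∀ t → ¬ I t → Dist≤2 G v t))
  where

  Dist≤2-sym : ∀ {u v} → Dist≤2 G u v → Dist≤2 G v u
  Dist≤2-sym (inj₁ u≡v)                  = inj₁ (sym u≡v)
  Dist≤2-sym (inj₂ (inj₁ uv))            = inj₂ (inj₁ (G-sym uv))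
  Dist≤2-sym (inj₂ (inj₂ (x , ux , xv))) = inj₂ (inj₂ (x , G-sym xv , G-sym ux))

  Dist≤2⇒Connected : ∀ {u v} → Dist≤2 G u v → Connected G u v
  Dist≤2⇒Connected (inj₁ refl)                 = refl′
  Dist≤2⇒Connected (inj₂ (inj₁ uv))            = edge uv refl′
  Dist≤2⇒Connected (inj₂ (inj₂ (_ , ux , xv))) = edge ux (edge xv refl′)

  Connected⇒≡⊎active : ∀ {u v} → Connected G u v → u ≡ v ⊎ (¬ I u × ¬ I v)
  Connected⇒≡⊎active refl′ = inj₁ refl
  Connected⇒≡⊎active (edge ux c) with Connected⇒≡⊎active c
  ... | inj₁ refl      = inj₂ (isolated ux , isolated (G-sym ux))
  ... | inj₂ (_ , ¬Iv) = inj₂ (isolated ux , ¬Iv)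

  active⇒Dist≤2 : ∀ s t → ¬ I s → ¬ I t → Dist≤2 G s t
  active⇒Dist≤2 s t ¬Is ¬It with classify s ¬Is | classify t ¬It
  ... | inj₂ (_ , ecc)   | _                = ecc t ¬It
  ... | _                | inj₂ (_ , ecc)   = Dist≤2-sym (ecc s ¬Is)
  ... | inj₁ (inj₁ refl) | inj₁ (inj₁ refl) = inj₁ refl
  ... | inj₁ (inj₁ refl) | inj₁ (inj₂ st)   = inj₂ (inj₁ st)
  ... | inj₁ (inj₂ ts)   | inj₁ (inj₁ refl) = inj₂ (inj₁ (G-sym ts))
  ... | inj₁ (inj₂ cs)   | inj₁ (inj₂ ct)   = inj₂ (inj₂ (c₁ , G-sym cs , ct))

  componentsDiam≤2 : ComponentsDiam≤2 G
  componentsDiam≤2 u v c with Connected⇒≡⊎active c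
  ... | inj₁ u≡v         = inj₁ u≡v
  ... | inj₂ (¬Iu , ¬Iv) = active⇒Dist≤2 u v ¬Iu ¬Iv

  allActive⇔connected : (∀ x → ¬ I x) ⇔ IsConnectedGraph G
  allActive⇔connected = mk⇔
    (λ active u v → Dist≤2⇒Connected (active⇒Dist≤2 u v (active u) (active v)))
    (λ connected x → active-start (Connected⇒≡⊎active (connected x c₁)))
    where
      active-start : ∀ {x} → x ≡ c₁ ⊎ (¬ I x × ¬ I c₁) → ¬ I x
      active-start (inj₁ refl)      = c₁-active
      active-start (inj₂ (¬Ix , _)) = ¬Ix

  inactive : Subset n
  inactive = tabulate (does ∘ I?)

  ∈inactive : ∀ {x} → I x → x ∈ inactive
  ∈inactive {x} Ix with I? x in eq
  ... | yes _ = lookup⇒[]= x inactive (trans (lookup∘tabulate (does ∘ I?) x) (cong does eq))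
  ... | no ¬Ix = ⊥-elim (¬Ix Ix)

  ∈inactive⇒inactive : ∀ {x} → x ∈ inactive → I x
  ∈inactive⇒inactive {x} x∈ with I? x | trans (sym (lookup∘tabulate (does ∘ I?) x)) ([]=⇒lookup x∈)
  ... | yes Ix | _ = Ix
  ... | no _   | ()

  inactive⊂dominating : ∀ {S} → Dominating G S → inactive ⊂ S
  inactive⊂dominating {S} dom = inactive⊆S , witness (dom c₁)
    where
      inactive⊆S : ∀ {x} → x ∈ inactive → x ∈ S
      inactive⊆S {x} x∈ with dom x
      ... | inj₁ x∈S          = x∈S
      ... | inj₂ (_ , _ , ux) = ⊥-elim (isolated (G-sym ux) (∈inactive⇒inactive x∈))
      witness : c₁ ∈ S ⊎ ∃ (λ u → u ∈ S × G u c₁) → ∃ λ x → x ∈ S × ¬ x ∈ inactive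
      witness (inj₁ c₁∈S)            = c₁ , c₁∈S , c₁-active ∘ ∈inactive⇒inactive
      witness (inj₂ (u , u∈S , uc₁)) = u , u∈S , isolated uc₁ ∘ ∈inactive⇒inactive

  dominator : Subset n
  dominator = inactive ∪ (⁅ c₁ ⁆ ∪ ⁅ c₂ ⁆)

  c₁∈dominator : c₁ ∈ dominator
  c₁∈dominator = x∈p∪q⁺ (inj₂ (x∈p∪q⁺ (inj₁ (x∈⁅x⁆ c₁))))

  c₂∈dominator : c₂ ∈ dominator
  c₂∈dominator = x∈p∪q⁺ (inj₂ (x∈p∪q⁺ (inj₂ (x∈⁅x⁆ c₂))))

  dominator-dominates : Dominating G dominator
  dominator-dominates v with I? v
  ... | yes Iv = inj₁ (x∈p∪q⁺ (inj₁ (∈inactive Iv)))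
  ... | no ¬Iv with classify v ¬Iv
  ... | inj₁ (inj₁ refl) = inj₁ c₁∈dominator
  ... | inj₁ (inj₂ c₁v)  = inj₂ (c₁ , c₁∈dominator , c₁v)
  ... | inj₂ (c₂v , _)   = inj₂ (c₂ , c₂∈dominator , c₂v)

  ∣dominator∣≤ : ∣ dominator ∣ ≤ ∣ inactive ∣ + 2
  ∣dominator∣≤ =
    ≤-trans (∣p∪q∣≤∣p∣+∣q∣ inactive _)
      (+-monoʳ-≤ ∣ inactive ∣
        (≤-trans (∣p∪q∣≤∣p∣+∣q∣ ⁅ c₁ ⁆ ⁅ c₂ ⁆) (≤-reflexive (cong₂ _+_ (∣⁅x⁆∣≡1 c₁) (∣⁅x⁆∣≡1 c₂)))))

  dominationNumber : ∀ m → ∣ inactive ∣ ≡ m → ∀ g → IsDominationNumber G g → g ≡ m + 1 ⊎ g ≡ m + 2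
  dominationNumber _ refl g ((S , dom , refl) , minimal) =
    m<g≤m+2⇒g≡m+1⊎g≡m+2 ∣ inactive ∣ g
      (p⊂q⇒∣p∣<∣q∣ (inactive⊂dominating dom))
      (≤-trans (minimal dominator dominator-dominates) ∣dominator∣≤)

module DigraphProperties {n} (D : Digraph n) where

  C12-sym : ∀ {u v} → C12 D u v → C12 D v u
  C12-sym (u≢v , w , w≢u , w≢v , inj₁ walks) = ≢-sym u≢v , w , w≢v , w≢u , inj₂ walks
  C12-sym (u≢v , w , w≢u , w≢v , inj₂ walks) = ≢-sym u≢v , w , w≢v , w≢u , inj₁ walks

  arc⇒¬Sink : ∀ {u v} → Arc D u v → ¬ Sink D u
  arc⇒¬Sink {v = v} uv sink with () ← trans (sym uv) (sink v)

  walk⇒¬Sink : ∀ {a j u w} → WalkAvoiding D a j u w → w ≢ u → ¬ Sink D u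
  walk⇒¬Sink (here _)      w≢u = ⊥-elim (w≢u refl)
  walk⇒¬Sink (step _ uy _) _   = arc⇒¬Sink uy

  C12⇒¬Sink : ∀ {u v} → C12 D u v → ¬ Sink D u
  C12⇒¬Sink (_ , _ , w≢u , _ , inj₁ (uw , _)) = walk⇒¬Sink uw w≢u
  C12⇒¬Sink (_ , _ , w≢u , _ , inj₂ (_ , uw)) = walk⇒¬Sink uw w≢u

  sink? : Decidable (Sink D)
  sink? x = all? (λ y → D x y ≟ᵇ false)

  ¬Sink⇒arc : ∀ {x} → ¬ Sink D x → ∃ λ y → Arc D x y
  ¬Sink⇒arc {x} ¬sink with ¬∀⟶∃¬ n _ (λ y → D x y ≟ᵇ false) ¬sink
  ... | y , xy≢false = y , ¬-not xy≢false

  walk? : ∀ a j x z → Dec (WalkAvoiding D a j x z)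
  walk? a j x z with x ≟ a | x ≟ z
  ... | yes refl | _ = no λ { (here x≢a) → x≢a refl ; (step x≢a _ _) → x≢a refl }
  ... | no x≢a | yes refl = yes (here x≢a)
  walk? a zero    x z | no x≢a | no x≢z = no λ { (here _) → x≢z refl }
  walk? a (suc j) x z | no x≢a | no x≢z =
    map′ (λ (_ , xy , yz) → step x≢a xy yz)
         (λ { (here _) → ⊥-elim (x≢z refl) ; (step _ xy yz) → _ , xy , yz })
         (any? λ y → (D x y ≟ᵇ true) ×-dec walk? a j y z)

  C12? : ∀ u v → Dec (C12 D u v)
  C12? u v = ¬? (u ≟ v) ×-dec any? λ w → ¬? (w ≟ u) ×-dec ¬? (w ≟ v) ×-dec
    ((walk? v 1 u w ×-dec walk? u 2 v w) ⊎-dec (walk? u 1 v w ×-dec walk? v 2 u w))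

  ¬Competing⇒nonadjacent : ∀ {k} {p : Fin n → Fin k} {i} → ¬ Competing p D i →
    ∃₂ λ x y → p x ≡ i × p y ≡ i × x ≢ y × ¬ C12 D x y
  ¬Competing⇒nonadjacent {p = p} {i} ¬competing =
    decidable-stable
      (any? λ x → any? λ y → (p x ≟ i) ×-dec (p y ≟ i) ×-dec ¬? (x ≟ y) ×-dec ¬? (C12? x y))
      λ noPair → ¬competing λ u v pu pv u≢v →
        decidable-stable (C12? u v) λ ¬uv → noPair (u , v , pu , pv , u≢v , ¬uv)

module MultipartiteTournament {n k} {p : Fin n → Fin k} {D : Digraph n}
  (mt : IsMultipartiteTournament k p D) where
  open IsMultipartiteTournament mt
  open DigraphProperties D

  arc⇒≢part : ∀ {u v} → Arc D u v → p u ≢ p v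
  arc⇒≢part {u} {v} uv pu≡pv with () ← trans (sym uv) (noArcInPart u v pu≡pv)

  arc-leaves-part : ∀ {u v i} → Arc D u v → p u ≡ i → p v ≢ i
  arc-leaves-part uv refl = arc⇒≢part uv ∘ sym

  ≢-across-part : ∀ {u v i} → p u ≢ i → p v ≡ i → u ≢ v
  ≢-across-part u∉ refl refl = u∉ refl

  ≢part⇒≢ : ∀ {u v} → p u ≢ p v → u ≢ v
  ≢part⇒≢ pu≢pv = pu≢pv ∘ cong p

  arc⇒≢ : ∀ {u v} → Arc D u v → u ≢ v
  arc⇒≢ = ≢part⇒≢ ∘ arc⇒≢part

  arc⊎arc : ∀ {u v} → p u ≢ p v → Arc D u v ⊎ Arc D v u
  arc⊎arc {u} {v} pu≢pv with orientation u v pu≢pv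
  ... | inj₁ (uv , _) = inj₁ uv
  ... | inj₂ (_ , vu) = inj₂ vu

  arc⇒¬arc : ∀ {u v} → Arc D u v → ¬ Arc D v u
  arc⇒¬arc {u} {v} uv vu with orientation u v (arc⇒≢part uv)
  ... | inj₁ (_ , vu≡false) with () ← trans (sym vu) vu≡false
  ... | inj₂ (uv≡false , _) with () ← trans (sym uv) uv≡false

  commonOut⇒C12 : ∀ {u v h} → u ≢ v → Arc D u h → Arc D v h → C12 D u v
  commonOut⇒C12 u≢v uh vh =
    u≢v , _ , ≢-sym (arc⇒≢ uh) , ≢-sym (arc⇒≢ vh) ,
    inj₁ (step u≢v uh (here (≢-sym (arc⇒≢ vh))) , step (≢-sym u≢v) vh (here (≢-sym (arc⇒≢ uh))))

  twoStep⇒C12 : ∀ {u v w h} → u ≢ v → Arc D u w → Arc D w h → Arc D v h → w ≢ v → C12 D u v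
  twoStep⇒C12 {u} {h = h} u≢v uw wh vh w≢v =
    u≢v , h , h≢u , ≢-sym (arc⇒≢ vh) ,
    inj₂ (step (≢-sym u≢v) vh (here h≢u) , step u≢v uw (step w≢v wh (here (≢-sym (arc⇒≢ vh)))))
    where
      h≢u : h ≢ u
      h≢u refl = arc⇒¬arc uw wh

  sink-absorbs : ∀ {u y} → Sink D y → p u ≢ p y → Arc D u y
  sink-absorbs sink pu≢py with arc⊎arc pu≢py
  ... | inj₁ uy = uy
  ... | inj₂ yu = ⊥-elim (arc⇒¬Sink yu sink)

  vertexAvoiding : (i j : Fin k) → ∃ λ v → p v ≢ i × p v ≢ j
  vertexAvoiding i j with fresh atLeast3Parts i j
  ... | l , l≢i , l≢j with partsNonempty l
  ... | v , refl = v , l≢i , l≢j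

  record Absorbing : Set where
    field
      core side : Fin k
      absorb : ∀ w → p w ≢ core →
        ∃ λ h → Arc D w h × (∀ u → p u ≢ core → p u ≢ side → Arc D u h)

  sink⇒absorbing : ∀ {y} → Sink D y → Absorbing
  sink⇒absorbing {y} sink = record
    { core   = p y
    ; side   = p y
    ; absorb = λ w w∉ → y , sink-absorbs sink w∉ , λ u u∉ _ → sink-absorbs sink u∉ }

  nonadjacent⇒absorbing : ∀ {x y a b} → p x ≡ p y → x ≢ y → ¬ C12 D x y →
    Arc D x a → Arc D y b → Absorbing
  nonadjacent⇒absorbing {x} {y} {a₀} {b₀} px≡py x≢y ¬xy xa₀ yb₀ = record
    { core = p x ; side = p b₀ ; absorb = absorb }
    where
      xOut≢y : ∀ {a} → Arc D x a → a ≢ y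
      xOut≢y xa = ≢-across-part (arc-leaves-part xa px≡py) refl

      yOut≢x : ∀ {b} → Arc D y b → b ≢ x
      yOut≢x yb = ≢-across-part (arc-leaves-part yb (sym px≡py)) refl

      outParts≡ : ∀ {a b} → Arc D x a → Arc D y b → p a ≡ p b
      outParts≡ {a} {b} xa yb with p a ≟ p b
      ... | yes pa≡pb = pa≡pb
      ... | no pa≢pb with arc⊎arc pa≢pb
      ... | inj₁ ab = ⊥-elim (¬xy (twoStep⇒C12 x≢y xa ab yb (xOut≢y xa)))
      ... | inj₂ ba = ⊥-elim (¬xy (C12-sym (twoStep⇒C12 (≢-sym x≢y) yb ba xa (yOut≢x yb))))

      xOut∈side : ∀ {a} → Arc D x a → p a ≡ p b₀
      xOut∈side xa = outParts≡ xa yb₀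

      yOut∈side : ∀ {b} → Arc D y b → p b ≡ p b₀
      yOut∈side yb = trans (sym (outParts≡ xa₀ yb)) (outParts≡ xa₀ yb₀)

      ∉px⇒∉py : ∀ {u} → p u ≢ p x → p u ≢ p y
      ∉px⇒∉py u∉ pu≡py = u∉ (trans pu≡py (sym px≡py))

      toTwin : ∀ {w} → p w ≢ p x → Arc D w x ⊎ Arc D w y
      toTwin w∉ with arc⊎arc w∉
      ... | inj₁ wx = inj₁ wx
      ... | inj₂ xw with arc⊎arc (∉px⇒∉py w∉)
      ... | inj₁ wy = inj₂ wy
      ... | inj₂ yw = ⊥-elim (¬xy (commonOut⇒C12 x≢y xw yw))

      toBothTwins : ∀ {u} → p u ≢ p x → p u ≢ p b₀ → Arc D u x × Arc D u y
      toBothTwins u∉core u∉side with arc⊎arc u∉core | arc⊎arc (∉px⇒∉py u∉core)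
      ... | inj₂ xu | _      = ⊥-elim (u∉side (xOut∈side xu))
      ... | inj₁ _  | inj₂ yu = ⊥-elim (u∉side (yOut∈side yu))
      ... | inj₁ ux | inj₁ uy = ux , uy

      absorb : ∀ w → p w ≢ p x →
        ∃ λ h → Arc D w h × (∀ u → p u ≢ p x → p u ≢ p b₀ → Arc D u h)
      absorb w w∉ with toTwin w∉
      ... | inj₁ wx = x , wx , λ u u∉core u∉side → proj₁ (toBothTwins u∉core u∉side)
      ... | inj₂ wy = y , wy , λ u u∉core u∉side → proj₂ (toBothTwins u∉core u∉side)

  loose⇒absorbing : Loose p D → Absorbing
  loose⇒absorbing (_ , ¬competing) with ¬Competing⇒nonadjacent ¬competing
  ... | x , y , px , py , x≢y , ¬xy with sink? x | sink? y
  ... | yes sink | _        = sink⇒absorbing sink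
  ... | no _     | yes sink = sink⇒absorbing sink
  ... | no ¬sx   | no ¬sy   =
    nonadjacent⇒absorbing (trans px (sym py)) x≢y ¬xy
      (proj₂ (¬Sink⇒arc ¬sx)) (proj₂ (¬Sink⇒arc ¬sy))

  module AbsorbingProperties (A : Absorbing) where
    open Absorbing A

    c₁ : Fin n
    c₁ = proj₁ (vertexAvoiding core side)

    c₁∉core : p c₁ ≢ core
    c₁∉core = proj₁ (proj₂ (vertexAvoiding core side))

    c₁∉side : p c₁ ≢ side
    c₁∉side = proj₂ (proj₂ (vertexAvoiding core side))

    c₂ : Fin n
    c₂ = proj₁ (vertexAvoiding core (p c₁))

    c₂∉core : p c₂ ≢ core
    c₂∉core = proj₁ (proj₂ (vertexAvoiding core (p c₁)))

    c₂∉c₁ : p c₂ ≢ p c₁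
    c₂∉c₁ = proj₂ (proj₂ (vertexAvoiding core (p c₁)))

    adjacent-outside : ∀ {u v} → u ≢ v → p u ≢ core → p u ≢ side → p v ≢ core → C12 D u v
    adjacent-outside u≢v u∉core u∉side v∉core with absorb _ v∉core
    ... | _ , vh , toH = commonOut⇒C12 u≢v (toH _ u∉core u∉side) vh

    c₁-¬Sink : ¬ Sink D c₁
    c₁-¬Sink = arc⇒¬Sink (proj₁ (proj₂ (absorb c₁ c₁∉core)))

    outside⇒near-c₁ : ∀ {v} → p v ≢ core → v ≡ c₁ ⊎ C12 D c₁ v
    outside⇒near-c₁ {v} v∉core with v ≟ c₁
    ... | yes v≡c₁ = inj₁ v≡c₁
    ... | no v≢c₁  = inj₂ (adjacent-outside (≢-sym v≢c₁) c₁∉core c₁∉side v∉core)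

    coreArc⇒adj-c₁ : ∀ {v w} → p v ≡ core → Arc D v w → w ≢ c₁ → C12 D c₁ v
    coreArc⇒adj-c₁ pv≡core vw w≢c₁ with absorb _ (arc-leaves-part vw pv≡core)
    ... | _ , wh , toH =
      C12-sym (twoStep⇒C12 (≢-sym (≢-across-part c₁∉core pv≡core)) vw wh
        (toH _ c₁∉core c₁∉side) w≢c₁)

    c₂-adj-c₁ : C12 D c₂ c₁
    c₂-adj-c₁ = C12-sym (adjacent-outside (≢-sym (≢part⇒≢ c₂∉c₁)) c₁∉core c₁∉side c₂∉core)

    coreArc-part-c₁⇒adj-c₂ : ∀ {t w} → p t ≡ core → Arc D t w → p w ≡ p c₁ → C12 D c₂ t
    coreArc-part-c₁⇒adj-c₂ pt≡core tw pw≡pc₁ with absorb c₂ c₂∉core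
    ... | _ , c₂h , toH =
      C12-sym (twoStep⇒C12 (≢-sym (≢-across-part c₂∉core pt≡core)) tw
        (toH _ (subst (_≢ core) (sym pw≡pc₁) c₁∉core) (subst (_≢ side) (sym pw≡pc₁) c₁∉side))
        c₂h (≢-sym (≢-across-part c₂∉c₁ pw≡pc₁)))

    coreArc-c₁⇒adj-c₂ : ∀ {v} → p v ≡ core → Arc D v c₁ → C12 D c₂ v
    coreArc-c₁⇒adj-c₂ pv≡core vc₁ = coreArc-part-c₁⇒adj-c₂ pv≡core vc₁ refl

    coreArc-c₁⇒adj-outside : ∀ {v t} → p v ≡ core → Arc D v c₁ → p t ≢ core → t ≢ c₁ → C12 D v t
    coreArc-c₁⇒adj-outside pv≡core vc₁ t∉core t≢c₁ with absorb _ t∉core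
    ... | _ , th , toH =
      twoStep⇒C12 (≢-sym (≢-across-part t∉core pv≡core)) vc₁
        (toH c₁ c₁∉core c₁∉side) th (≢-sym t≢c₁)

    coreArc-c₁⇒eccentricity≤2 : ∀ {v} → p v ≡ core → Arc D v c₁ →
      ∀ t → ¬ Sink D t → Dist≤2 (C12 D) v t
    coreArc-c₁⇒eccentricity≤2 {v} pv≡core vc₁ t ¬sink with v ≟ t | t ≟ c₁ | p t ≟ core
    ... | yes v≡t | _       | _          = inj₁ v≡t
    ... | no _    | yes refl | _         =
      inj₂ (inj₂ (c₂ , C12-sym (coreArc-c₁⇒adj-c₂ pv≡core vc₁) , c₂-adj-c₁))
    ... | no _    | no t≢c₁ | no t∉core =
      inj₂ (inj₁ (coreArc-c₁⇒adj-outside pv≡core vc₁ t∉core t≢c₁))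
    ... | no v≢t  | no _    | yes pt≡core with ¬Sink⇒arc ¬sink
    ... | w , tw with p w ≟ p c₁
    ... | yes pw≡pc₁ =
      inj₂ (inj₂ (c₂ , C12-sym (coreArc-c₁⇒adj-c₂ pv≡core vc₁) ,
                  coreArc-part-c₁⇒adj-c₂ pt≡core tw pw≡pc₁))
    ... | no pw≢pc₁ with arc⊎arc pw≢pc₁
    ... | inj₁ wc₁ = inj₂ (inj₁ (C12-sym (twoStep⇒C12 (≢-sym v≢t) tw wc₁ vc₁
                       (≢-across-part (arc-leaves-part tw pt≡core) pv≡core))))
    ... | inj₂ c₁w = inj₂ (inj₁ (twoStep⇒C12 v≢t vc₁ c₁w tw (≢-across-part c₁∉core pt≡core)))

    classify : ∀ v → ¬ Sink D v →
      (v ≡ c₁ ⊎ C12 D c₁ v) ⊎ (C12 D c₂ v × ∀ t → ¬ Sink D t → Dist≤2 (C12 D) v t)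
    classify v ¬sink with p v ≟ core
    ... | no v∉core = inj₁ (outside⇒near-c₁ v∉core)
    ... | yes pv≡core with ¬Sink⇒arc ¬sink
    ... | w , vw with w ≟ c₁
    ... | yes refl = inj₂ (coreArc-c₁⇒adj-c₂ pv≡core vw , coreArc-c₁⇒eccentricity≤2 pv≡core vw)
    ... | no w≢c₁  = inj₁ (inj₂ (coreArc⇒adj-c₁ pv≡core vw w≢c₁))

    stable⇒⊆twoParts : ∀ S → Stable (C12 D) S → ∃₂ λ i j → ∀ v → v ∈ S → p v ≡ i ⊎ p v ≡ j
    stable⇒⊆twoParts S stable with any? (λ v → (v ∈? S) ×-dec ¬? (p v ≟ core) ×-dec ¬? (p v ≟ side))
    ... | yes (v , v∈S , v∉core , v∉side) = core , p v , onlyV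
      where
        onlyV : ∀ u → u ∈ S → p u ≡ core ⊎ p u ≡ p v
        onlyV u u∈S with p u ≟ core | u ≟ v
        ... | yes pu≡core | _       = inj₁ pu≡core
        ... | no _        | yes refl = inj₂ refl
        ... | no u∉core   | no u≢v  =
          ⊥-elim (stable v u v∈S u∈S (adjacent-outside (≢-sym u≢v) v∉core v∉side u∉core))
    ... | no noneOutside = core , side , inCoreOrSide
      where
        inCoreOrSide : ∀ u → u ∈ S → p u ≡ core ⊎ p u ≡ side
        inCoreOrSide u u∈S with p u ≟ core | p u ≟ side
        ... | yes pu≡core | _           = inj₁ pu≡core
        ... | no _        | yes pu≡side = inj₂ pu≡side
        ... | no u∉core   | no u∉side   = ⊥-elim (noneOutside (u , u∈S , u∉core , u∉side))

    ¬Competing⇒core⊎side : ∀ l → ¬ Competing p D l → l ≡ core ⊎ l ≡ side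
    ¬Competing⇒core⊎side l ¬competing with l ≟ core | l ≟ side
    ... | yes l≡core | _          = inj₁ l≡core
    ... | no _       | yes l≡side = inj₂ l≡side
    ... | no l≢core  | no l≢side  = ⊥-elim (¬competing λ u v pu≡l pv≡l u≢v →
      adjacent-outside u≢v (subst (_≢ core) (sym pu≡l) l≢core) (subst (_≢ side) (sym pu≡l) l≢side)
        (subst (_≢ core) (sym pv≡l) l≢core))

theorem3p5 : ∀ {n k : ℕ} (p : Fin n → Fin k) (D : Digraph n) →
    IsMultipartiteTournament k p D → Loose p D →
    ComponentsDiam≤2 (C12 D)
    × ((∀ x → ¬ Sink D x) ⇔ IsConnectedGraph (C12 D))
    × (∀ (S : Subset n) → Stable (C12 D) S →
         ∃ λ (i : Fin k) → ∃ λ (j : Fin k) → ∀ v → v ∈ S → p v ≡ i ⊎ p v ≡ j)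
    × (∃ λ (i : Fin k) → ∃ λ (j : Fin k) → ∀ l → ¬ Competing p D l → l ≡ i ⊎ l ≡ j)
    × (∀ (m : ℕ) → numSinks D ≡ m → HasEdge (C12 D) →
         ∀ (g : ℕ) → IsDominationNumber (C12 D) g → g ≡ m + 1 ⊎ g ≡ m + 2)
theorem3p5 p D mt loose =
  componentsDiam≤2 ,
  allActive⇔connected ,
  stable⇒⊆twoParts ,
  (core , side , ¬Competing⇒core⊎side) ,
  λ m numSinks≡m _ →
    dominationNumber m (trans (sym (length-filter-tabulate sink? (λ x → x))) numSinks≡m)
  where
    open DigraphProperties D
    open MultipartiteTournament mt
    absorbing : Absorbing
    absorbing = loose⇒absorbing loose
    open Absorbing absorbing
    open AbsorbingProperties absorbing
    open TwoCentres (C12 D) C12-sym sink? C12⇒¬Sink c₁ c₂ c₁-¬Sink classify
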